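{- Let $\beta(2^X,\mathrm{Jac})$ denote the minimum size of a subset of $2^X$ resolving $(2^X,\mathrm{Jac})$. Then $\beta(2^X,\mathrm{Jac})=\Theta\left(\frac{|X|}{\ln|X|}\right)$ as $|X|\to\infty$, where $X$ ranges over finite non-empty sets.
   Context: For a finite set $X$, $2^X$ is its power set. The Jaccard distance on $2^X$ is $\mathrm{Jac}(a,b)=|a\,\Delta\, b|/|a\cup b|$ for $a\neq b$ and $\mathrm{Jac}(a,a)=0$, where $\Delta$ is symmetric difference. A non-empty set $R\subseteq 2^X$ resolves $(2^X,\mathrm{Jac})$ if the map $a\mapsto (\mathrm{Jac}(a,r))_{r\in R}$ is injective on $2^X$. -}

module Defs where

open import Data.Nat using (ℕ; zero; suc; _≤_; _*_)
open import Data.Nat.Logarithm using (⌊log₂_⌋)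
open import Data.Bool using (Bool)
import Data.Bool.Properties as BoolP
open import Data.Vec.Properties using (≡-dec)
open import Data.Fin.Subset using (Subset; _∪_; _─_; ∣_∣)
open import Data.Integer using (+_)
open import Data.Rational using (ℚ; _/_; 0ℚ)
open import Data.List using (List; length; map)
open import Data.List.Relation.Unary.Unique.Propositional using (Unique)
open import Data.List.Relation.Unary.Any using (Any)
open import Data.Product using (Σ; _×_; ∃)
open import Relation.Binary.PropositionalEquality using (_≡_)
open import Relation.Nullary using (yes; no)
open import Function.Definitions using (Injective)
open import Data.Unit using (⊤)

-- The ground set X is Fin n; its power set 2^X is Subset n.

_Δ_ : ∀ {n} → Subset n → Subset n → Subset n
a Δ b = (a ─ b) ∪ (b ─ a)

_≟ˢ_ : ∀ {n} (a b : Subset n) → _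
_≟ˢ_ = ≡-dec BoolP._≟_

-- Jaccard distance: Jac(a,a) = 0, and |a Δ b| / |a ∪ b| for a ≠ b
-- (for a ≠ b the union is non-empty; the zero branch is unreachable then).
Jac : ∀ {n} → Subset n → Subset n → ℚ
Jac a b with a ≟ˢ b
... | yes _ = 0ℚ
... | no _ with ∣ a ∪ b ∣
...   | zero = 0ℚ
...   | suc k = (+ ∣ a Δ b ∣) / suc k

-- R (a finite family of subsets, listed without repetition) resolves
-- (2^X, Jac): R is non-empty and a ↦ (Jac(a,r))_{r ∈ R} is injective.
Resolves : ∀ {n} → List (Subset n) → Set
Resolves {n} R = Any (λ _ → ⊤) R × Injective _≡_ _≡_ (λ (a : Subset n) → map (Jac a) R)

IsMetricDim : ℕ → ℕ → Set
IsMetricDim n k =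
  (∃ λ (R : List (Subset n)) → Unique R × Resolves R × length R ≡ k)
  × (∀ (R : List (Subset n)) → Unique R → Resolves R → k ≤ length R)

-- Lower bound: Jac a r is a function of the pair (∣ a Δ r ∣ , ∣ a ∪ r ∣) ∈ [0, n]², so a resolving
-- set R injects the 2ⁿ subsets into the ((n + 1)²)^∣R∣ vectors of such pairs, whence
-- n ≤ 2 (1 + log₂ n) ∣R∣.
--
-- Upper bound: Jac a X = 1 − ∣ a ∣ / n reveals ∣ a ∣, and once ∣ a ∣ is known, Jac a r reveals
-- ∣ a ∩ r ∣. So X together with a detecting family (sets whose intersection sizes with a determine a,
-- as in coin weighing) resolves 2^X. A detecting family D of m sets on n points yields one of 2m + 1
-- sets on 2n + m points, with rows (∅, X, ∅), (D i, D i, {i}) and (D i, ∁ D i, ∅) over three blocks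
-- of columns: on a = x ++ y ++ z the last two rows sum to ∣ z ∩ {i} ∣ + 2 ∣ x ∩ D i ∣ + ∣ y ∣, and
-- parity separates the terms. Iterating gives 2^{j+1} − 1 sets on j 2^j + 1 points; for j ≈ ½ log₂ n, disjoint copies
-- of this family cover X with O(n / log n) sets.

module Submission where

open import Defs
open import Data.Nat using (ℕ; zero; suc; _+_; _*_; _^_; _∸_; _≤_; _<_; z≤n; s≤s; NonZero; >-nonZero; >-nonZero⁻¹; ⌊_/2⌋; ⌈_/2⌉)
open import Data.Nat.DivMod using (_%_; _/_; [m+kn]%n≡m%n; m<n⇒m%n≡m; m≡m%n+[m/n]*n; m%n<n; m/n*n≤m)
open import Data.Nat.Logarithm using (⌊log₂_⌋; ⌊log₂⌋-mono-≤; ⌊log₂[2^n]⌋≡n; ⌊log₂⌊n/2⌋⌋≡⌊log₂n⌋∸1)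
open import Data.Nat.Properties
open import Data.Nat.Tactic.RingSolver using (solve-∀)
open import Data.Bool using (_∧_)
open import Data.Vec using ([]; _∷_; _++_; take)
import Data.Vec as Vec
open import Data.Vec.Properties using (lookup∘tabulate; zipWith-++; take++drop≡id; ++-injectiveˡ)
open import Data.Fin using (Fin; zero; suc; fromℕ<; combine; funToFin; finToFun)
open import Data.Fin.Properties using (+↔⊎; 2↔Bool; fromℕ<-injective; combine-injectiveˡ; combine-injectiveʳ; funToFin-finToFin; finToFun-funToFin; injective⇒≤)
open import Data.Fin.Subset using (Subset; inside; outside; _∩_; _∪_; ∁; ⊤; ⊥; ⁅_⁆; ∣_∣)
open import Data.Fin.Subset.Properties using (∣p∣≤n; ∣p∩q∣≤∣q∣; ∣⁅x⁆∣≡1; ∣⊥∣≡0; ∣⊤∣≡n; ∩-zeroˡ; ∩-zeroʳ; ∩-identityʳ; ∪-zeroʳ; ∩-idem; ∪-idem)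
open import Data.Product using (Σ; ∃; _×_; _,_; proj₁; proj₂)
open import Data.Sum using (_⊎_; inj₁; inj₂; [_,_]′)
open import Data.Empty using (⊥-elim)
open import Data.List using (List; []; _∷_; map; length; tabulate; lookup; deduplicate)
open import Data.List.Properties using (∷-injectiveˡ; ∷-injectiveʳ; length-tabulate; length-deduplicate; map-cong-local; tabulate-lookup)
open import Data.List.Membership.Propositional using (_∈_)
open import Data.List.Membership.Propositional.Properties using (∈-tabulate⁺; ∈-deduplicate⁺)
open import Data.List.Relation.Unary.All using (All)
open import Data.List.Relation.Unary.All.Properties using (tabulate⁺)
open import Data.List.Relation.Unary.Any using (here; there)
import Data.List.Relation.Unary.Any as Any
open import Data.List.Relation.Unary.Unique.Propositional using (Unique)
open import Data.List.Relation.Unary.Unique.DecPropositional.Properties using (deduplicate-!)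
import Data.Unit as Unit
open import Function using (_∘_; _↔_; Inverse; Injection)
open import Function.Definitions using (Injective)
open import Function.Properties.Inverse using (↔-refl; ↔-trans; ↔⇒↣)
open import Data.Sum.Function.Propositional using (_⊎-↔_)
import Data.Integer as ℤ
open import Data.Rational using (ℚ; 0ℚ)
import Data.Rational as ℚ
open import Data.Rational.Properties using (normalize-injective-≃; 0/n≡0)
open import Relation.Nullary using (yes; no)
open import Relation.Binary.PropositionalEquality

-- Cardinalities of subsets

∣p++q∣≡∣p∣+∣q∣ : ∀ {m n} (p : Subset m) (q : Subset n) → ∣ p ++ q ∣ ≡ ∣ p ∣ + ∣ q ∣
∣p++q∣≡∣p∣+∣q∣ []            q = refl
∣p++q∣≡∣p∣+∣q∣ (inside ∷ p)  q = cong suc (∣p++q∣≡∣p∣+∣q∣ p q)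
∣p++q∣≡∣p∣+∣q∣ (outside ∷ p) q = ∣p++q∣≡∣p∣+∣q∣ p q

∣p++q∩r++s∣ : ∀ {m n} (p r : Subset m) (q s : Subset n) →
              ∣ (p ++ q) ∩ (r ++ s) ∣ ≡ ∣ p ∩ r ∣ + ∣ q ∩ s ∣
∣p++q∩r++s∣ p r q s = trans (cong ∣_∣ (zipWith-++ _∧_ p q r s)) (∣p++q∣≡∣p∣+∣q∣ (p ∩ r) (q ∩ s))

∣p∩⊥∣≡0 : ∀ {n} (p : Subset n) → ∣ p ∩ ⊥ ∣ ≡ 0
∣p∩⊥∣≡0 {n} p = trans (cong ∣_∣ (∩-zeroʳ p)) (∣⊥∣≡0 n)

∣⊥∩p∣≡0 : ∀ {n} (p : Subset n) → ∣ ⊥ ∩ p ∣ ≡ 0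
∣⊥∩p∣≡0 {n} p = trans (cong ∣_∣ (∩-zeroˡ p)) (∣⊥∣≡0 n)

∣p∩⊤∣≡∣p∣ : ∀ {n} (p : Subset n) → ∣ p ∩ ⊤ ∣ ≡ ∣ p ∣
∣p∩⊤∣≡∣p∣ p = cong ∣_∣ (∩-identityʳ p)

∣p∪⊤∣≡n : ∀ {n} (p : Subset n) → ∣ p ∪ ⊤ ∣ ≡ n
∣p∪⊤∣≡n {n} p = trans (cong ∣_∣ (∪-zeroʳ p)) (∣⊤∣≡n n)

∣p++q∩r++⊥∣≡∣p∩r∣ : ∀ {m n} (p r : Subset m) (q : Subset n) → ∣ (p ++ q) ∩ (r ++ ⊥) ∣ ≡ ∣ p ∩ r ∣
∣p++q∩r++⊥∣≡∣p∩r∣ p r q =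
  trans (∣p++q∩r++s∣ p r q ⊥) (trans (cong (∣ p ∩ r ∣ +_) (∣p∩⊥∣≡0 q)) (+-identityʳ _))

∣p++q∩⊥++s∣≡∣q∩s∣ : ∀ {m n} (p : Subset m) (q s : Subset n) → ∣ (p ++ q) ∩ (⊥ ++ s) ∣ ≡ ∣ q ∩ s ∣
∣p++q∩⊥++s∣≡∣q∩s∣ p q s = trans (∣p++q∩r++s∣ p ⊥ q s) (cong (_+ ∣ q ∩ s ∣) (∣p∩⊥∣≡0 p))

∣p++⊥∩q∣≡∣p∩take∣ : ∀ {n k} (p : Subset n) (q : Subset (n + k)) → ∣ (p ++ ⊥) ∩ q ∣ ≡ ∣ p ∩ take n q ∣
∣p++⊥∩q∣≡∣p∩take∣ {n} p q = begin
  ∣ (p ++ ⊥) ∩ q ∣                               ≡⟨ cong (λ r → ∣ (p ++ ⊥) ∩ r ∣) (take++drop≡id n q) ⟨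
  ∣ (p ++ ⊥) ∩ (take n q ++ Vec.drop n q) ∣     ≡⟨ ∣p++q∩r++s∣ p (take n q) ⊥ (Vec.drop n q) ⟩
  ∣ p ∩ take n q ∣ + ∣ ⊥ ∩ Vec.drop n q ∣       ≡⟨ cong (∣ p ∩ take n q ∣ +_) (∣⊥∩p∣≡0 (Vec.drop n q)) ⟩
  ∣ p ∩ take n q ∣ + 0                          ≡⟨ +-identityʳ _ ⟩
  ∣ p ∩ take n q ∣                               ∎
  where open ≡-Reasoning

∣p∪q∣+∣p∩q∣≡∣p∣+∣q∣ : ∀ {n} (p q : Subset n) → ∣ p ∪ q ∣ + ∣ p ∩ q ∣ ≡ ∣ p ∣ + ∣ q ∣
∣p∪q∣+∣p∩q∣≡∣p∣+∣q∣ []            []            = refl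
∣p∪q∣+∣p∩q∣≡∣p∣+∣q∣ (inside ∷ p)  (inside ∷ q)  =
  cong suc (trans (+-suc _ _) (trans (cong suc (∣p∪q∣+∣p∩q∣≡∣p∣+∣q∣ p q)) (sym (+-suc _ _))))
∣p∪q∣+∣p∩q∣≡∣p∣+∣q∣ (inside ∷ p)  (outside ∷ q) = cong suc (∣p∪q∣+∣p∩q∣≡∣p∣+∣q∣ p q)
∣p∪q∣+∣p∩q∣≡∣p∣+∣q∣ (outside ∷ p) (inside ∷ q)  =
  trans (cong suc (∣p∪q∣+∣p∩q∣≡∣p∣+∣q∣ p q)) (sym (+-suc _ _))
∣p∪q∣+∣p∩q∣≡∣p∣+∣q∣ (outside ∷ p) (outside ∷ q) = ∣p∪q∣+∣p∩q∣≡∣p∣+∣q∣ p q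

∣pΔq∣+∣p∩q∣≡∣p∪q∣ : ∀ {n} (p q : Subset n) → ∣ p Δ q ∣ + ∣ p ∩ q ∣ ≡ ∣ p ∪ q ∣
∣pΔq∣+∣p∩q∣≡∣p∪q∣ []            []            = refl
∣pΔq∣+∣p∩q∣≡∣p∪q∣ (inside ∷ p)  (inside ∷ q)  = trans (+-suc _ _) (cong suc (∣pΔq∣+∣p∩q∣≡∣p∪q∣ p q))
∣pΔq∣+∣p∩q∣≡∣p∪q∣ (inside ∷ p)  (outside ∷ q) = cong suc (∣pΔq∣+∣p∩q∣≡∣p∪q∣ p q)
∣pΔq∣+∣p∩q∣≡∣p∪q∣ (outside ∷ p) (inside ∷ q)  = cong suc (∣pΔq∣+∣p∩q∣≡∣p∪q∣ p q)
∣pΔq∣+∣p∩q∣≡∣p∪q∣ (outside ∷ p) (outside ∷ q) = ∣pΔq∣+∣p∩q∣≡∣p∪q∣ p q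

∣p∩∁q∣+∣p∩q∣≡∣p∣ : ∀ {n} (p q : Subset n) → ∣ p ∩ ∁ q ∣ + ∣ p ∩ q ∣ ≡ ∣ p ∣
∣p∩∁q∣+∣p∩q∣≡∣p∣ []            []            = refl
∣p∩∁q∣+∣p∩q∣≡∣p∣ (inside ∷ p)  (inside ∷ q)  = trans (+-suc _ _) (cong suc (∣p∩∁q∣+∣p∩q∣≡∣p∣ p q))
∣p∩∁q∣+∣p∩q∣≡∣p∣ (inside ∷ p)  (outside ∷ q) = cong suc (∣p∩∁q∣+∣p∩q∣≡∣p∣ p q)
∣p∩∁q∣+∣p∩q∣≡∣p∣ (outside ∷ p) (_ ∷ q)       = ∣p∩∁q∣+∣p∩q∣≡∣p∣ p q

∣pΔq∣≤∣p∪q∣ : ∀ {n} (p q : Subset n) → ∣ p Δ q ∣ ≤ ∣ p ∪ q ∣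
∣pΔq∣≤∣p∪q∣ p q = ≤-trans (m≤m+n _ _) (≤-reflexive (∣pΔq∣+∣p∩q∣≡∣p∪q∣ p q))

∣pΔp∣≡0 : ∀ {n} (p : Subset n) → ∣ p Δ p ∣ ≡ 0
∣pΔp∣≡0 p = +-cancelʳ-≡ ∣ p ∣ ∣ p Δ p ∣ 0 (begin
  ∣ p Δ p ∣ + ∣ p ∣     ≡⟨ cong (λ q → ∣ p Δ p ∣ + ∣ q ∣) (∩-idem p) ⟨
  ∣ p Δ p ∣ + ∣ p ∩ p ∣ ≡⟨ ∣pΔq∣+∣p∩q∣≡∣p∪q∣ p p ⟩
  ∣ p ∪ p ∣             ≡⟨ cong ∣_∣ (∪-idem p) ⟩
  ∣ p ∣                 ∎)
  where open ≡-Reasoning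

∣pΔ⊤∣+∣p∣≡n : ∀ {n} (p : Subset n) → ∣ p Δ ⊤ ∣ + ∣ p ∣ ≡ n
∣pΔ⊤∣+∣p∣≡n p = trans (cong (∣ p Δ ⊤ ∣ +_) (sym (∣p∩⊤∣≡∣p∣ p)))
                      (trans (∣pΔq∣+∣p∩q∣≡∣p∪q∣ p ⊤) (∣p∪⊤∣≡n p))

-- The Jaccard distance

-- d / u, with the junk value 0 at u = 0 that Jac also uses.
ratio : ℕ → ℕ → ℚ
ratio d zero    = 0ℚ
ratio d (suc u) = ℤ.+ d ℚ./ suc u

Jac≡ratio : ∀ {n} (a r : Subset n) → Jac a r ≡ ratio ∣ a Δ r ∣ ∣ a ∪ r ∣
Jac≡ratio a r with a ≟ˢ r
... | yes refl rewrite ∣pΔp∣≡0 a = sym (ratio-0 ∣ a ∪ a ∣)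
  where
  ratio-0 : ∀ u → ratio 0 u ≡ 0ℚ
  ratio-0 zero    = refl
  ratio-0 (suc u) = 0/n≡0 (suc u)
... | no _ with ∣ a ∪ r ∣
...   | zero  = refl
...   | suc _ = refl

ratio-cross : ∀ {d u d′ u′} → d ≤ u → d′ ≤ u′ → ratio d u ≡ ratio d′ u′ → d * u′ ≡ d′ * u
ratio-cross {u = zero}  {d′}    {u′ = zero}  z≤n z≤n eq = refl
ratio-cross {u = zero}  {d′}    {u′ = suc _} z≤n _   eq = sym (*-zeroʳ d′)
ratio-cross {d} {suc _} {u′ = zero}  _   z≤n eq = *-zeroʳ d
ratio-cross {d} {suc u} {d′} {suc u′} _ _ eq = normalize-injective-≃ d d′ (suc u) (suc u′) eq

Jac-cross : ∀ {n} (a b r : Subset n) → Jac a r ≡ Jac b r →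
            ∣ a Δ r ∣ * ∣ b ∪ r ∣ ≡ ∣ b Δ r ∣ * ∣ a ∪ r ∣
Jac-cross a b r eq = ratio-cross (∣pΔq∣≤∣p∪q∣ a r) (∣pΔq∣≤∣p∪q∣ b r)
  (trans (sym (Jac≡ratio a r)) (trans eq (Jac≡ratio b r)))

-- For d = ∣ a Δ r ∣ and s = ∣ a ∩ r ∣, t = d + 2s = ∣ a ∣ + ∣ r ∣ and Jac a r = d / (d + s) = (t − 2s) / (t − s),
-- which is injective in s once t is fixed.
ratio-determines-overlap : ∀ {d s d′ s′} → d + s + s ≡ d′ + s′ + s′ →
                           d * (d′ + s′) ≡ d′ * (d + s) → s ≡ s′
ratio-determines-overlap {d} {s} {d′} {s′} t≡t′ cross = cancel (d + s + s) refl t≡t′ ts′≡ts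
  where
  open ≡-Reasoning
  ds′≡d′s : d * s′ ≡ d′ * s
  ds′≡d′s = +-cancelˡ-≡ (d * d′) _ _ (begin
    d * d′ + d * s′   ≡⟨ *-distribˡ-+ d d′ s′ ⟨
    d * (d′ + s′)     ≡⟨ cross ⟩
    d′ * (d + s)      ≡⟨ *-distribˡ-+ d′ d s ⟩
    d′ * d + d′ * s   ≡⟨ cong (_+ d′ * s) (*-comm d′ d) ⟩
    d * d′ + d′ * s   ∎)
  expand : ∀ d s x → (d + s + s) * x ≡ d * x + (s + s) * x
  expand = solve-∀
  ts′≡ts : (d + s + s) * s′ ≡ (d + s + s) * s
  ts′≡ts = begin
    (d + s + s) * s′       ≡⟨ expand d s s′ ⟩
    d * s′ + (s + s) * s′  ≡⟨ cong (_+ (s + s) * s′) ds′≡d′s ⟩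
    d′ * s + (s + s) * s′  ≡⟨ swap d′ s s′ ⟩
    d′ * s + (s′ + s′) * s ≡⟨ expand d′ s′ s ⟨
    (d′ + s′ + s′) * s     ≡⟨ cong (_* s) t≡t′ ⟨
    (d + s + s) * s        ∎
    where
    swap : ∀ d′ s s′ → d′ * s + (s + s) * s′ ≡ d′ * s + (s′ + s′) * s
    swap = solve-∀
  cancel : ∀ t → d + s + s ≡ t → t ≡ d′ + s′ + s′ → t * s′ ≡ t * s → s ≡ s′
  cancel zero    t≡0 0≡t′ _ = trans (m+n≡0⇒n≡0 (d + s) t≡0) (sym (m+n≡0⇒n≡0 (d′ + s′) (sym 0≡t′)))
  cancel (suc t) _   _    e = sym (*-cancelˡ-≡ s′ s (suc t) e)

Jac-⊤⇒∣∣≡ : ∀ {n} (a b : Subset n) → Jac a ⊤ ≡ Jac b ⊤ → ∣ a ∣ ≡ ∣ b ∣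
Jac-⊤⇒∣∣≡ {zero}  []  []  _  = refl
Jac-⊤⇒∣∣≡ {suc n} a   b   eq = +-cancelˡ-≡ ∣ a Δ ⊤ ∣ _ _ (begin
  ∣ a Δ ⊤ ∣ + ∣ a ∣ ≡⟨ ∣pΔ⊤∣+∣p∣≡n a ⟩
  suc n             ≡⟨ ∣pΔ⊤∣+∣p∣≡n b ⟨
  ∣ b Δ ⊤ ∣ + ∣ b ∣ ≡⟨ cong (_+ ∣ b ∣) ∣aΔ⊤∣≡∣bΔ⊤∣ ⟨
  ∣ a Δ ⊤ ∣ + ∣ b ∣ ∎)
  where
  open ≡-Reasoning
  ∣aΔ⊤∣≡∣bΔ⊤∣ : ∣ a Δ ⊤ ∣ ≡ ∣ b Δ ⊤ ∣
  ∣aΔ⊤∣≡∣bΔ⊤∣ = *-cancelʳ-≡ _ _ (suc n)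
    (subst₂ (λ u v → ∣ a Δ ⊤ ∣ * u ≡ ∣ b Δ ⊤ ∣ * v) (∣p∪⊤∣≡n b) (∣p∪⊤∣≡n a) (Jac-cross a b ⊤ eq))

Jac⇒∣∩∣≡ : ∀ {n} (a b r : Subset n) → ∣ a ∣ ≡ ∣ b ∣ → Jac a r ≡ Jac b r → ∣ a ∩ r ∣ ≡ ∣ b ∩ r ∣
Jac⇒∣∩∣≡ a b r ∣a∣≡∣b∣ eq = ratio-determines-overlap
  (trans (d+s+s≡∣p∣+∣r∣ a) (trans (cong (_+ ∣ r ∣) ∣a∣≡∣b∣) (sym (d+s+s≡∣p∣+∣r∣ b))))
  (subst₂ (λ u v → ∣ a Δ r ∣ * u ≡ ∣ b Δ r ∣ * v)
          (sym (∣pΔq∣+∣p∩q∣≡∣p∪q∣ b r)) (sym (∣pΔq∣+∣p∩q∣≡∣p∪q∣ a r)) (Jac-cross a b r eq))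
  where
  d+s+s≡∣p∣+∣r∣ : ∀ p → ∣ p Δ r ∣ + ∣ p ∩ r ∣ + ∣ p ∩ r ∣ ≡ ∣ p ∣ + ∣ r ∣
  d+s+s≡∣p∣+∣r∣ p = trans (cong (_+ ∣ p ∩ r ∣) (∣pΔq∣+∣p∩q∣≡∣p∪q∣ p r)) (∣p∪q∣+∣p∩q∣≡∣p∣+∣q∣ p r)

-- Powers of two, division and logarithms

n<2^n : ∀ n → n < 2 ^ n
n<2^n zero    = s≤s z≤n
n<2^n (suc n) = begin
  suc (suc n)      ≡⟨ +-comm 1 (suc n) ⟩
  suc n + 1        ≤⟨ +-mono-≤ (n<2^n n) (m^n>0 2 n) ⟩
  2 ^ n + 2 ^ n    ≡⟨ cong (2 ^ n +_) (+-identityʳ (2 ^ n)) ⟨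
  2 * 2 ^ n        ∎
  where open ≤-Reasoning

⌊n/2⌋+⌊n/2⌋≤n : ∀ n → ⌊ n /2⌋ + ⌊ n /2⌋ ≤ n
⌊n/2⌋+⌊n/2⌋≤n n = ≤-trans (+-monoʳ-≤ ⌊ n /2⌋ (⌊n/2⌋≤⌈n/2⌉ n)) (≤-reflexive (⌊n/2⌋+⌈n/2⌉≡n n))

2^-cancel-≤ : ∀ {a b} → 2 ^ a ≤ 2 ^ b → a ≤ b
2^-cancel-≤ {a} {b} 2^a≤2^b = subst₂ _≤_ (⌊log₂[2^n]⌋≡n a) (⌊log₂[2^n]⌋≡n b) (⌊log₂⌋-mono-≤ 2^a≤2^b)

n<2^[1+⌊log₂n⌋] : ∀ n → n < 2 ^ suc ⌊log₂ n ⌋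
n<2^[1+⌊log₂n⌋] n = ≰⇒> λ 2^[1+L]≤n →
  1+n≰n (subst (_≤ ⌊log₂ n ⌋) (⌊log₂[2^n]⌋≡n (suc ⌊log₂ n ⌋)) (⌊log₂⌋-mono-≤ 2^[1+L]≤n))

2^⌊log₂n⌋≤n : ∀ n .{{_ : NonZero n}} → 2 ^ ⌊log₂ n ⌋ ≤ n
2^⌊log₂n⌋≤n n = 2^L≤n ⌊log₂ n ⌋ n refl
  where
  2^L≤n : ∀ L n .{{_ : NonZero n}} → ⌊log₂ n ⌋ ≡ L → 2 ^ L ≤ n
  2^L≤n zero    n             _  = >-nonZero⁻¹ n
  2^L≤n (suc L) (suc zero)    ()
  2^L≤n (suc L) n@(suc (suc k)) eq = begin
    2 * 2 ^ L          ≤⟨ *-monoʳ-≤ 2 (2^L≤n L ⌊ n /2⌋ log₂⌊n/2⌋≡L) ⟩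
    2 * ⌊ n /2⌋        ≡⟨ cong (⌊ n /2⌋ +_) (+-identityʳ ⌊ n /2⌋) ⟩
    ⌊ n /2⌋ + ⌊ n /2⌋  ≤⟨ ⌊n/2⌋+⌊n/2⌋≤n n ⟩
    n                  ∎
    where
    open ≤-Reasoning
    log₂⌊n/2⌋≡L : ⌊log₂ ⌊ n /2⌋ ⌋ ≡ L
    log₂⌊n/2⌋≡L = trans (⌊log₂⌊n/2⌋⌋≡⌊log₂n⌋∸1 n) (cong (_∸ 1) eq)

L≤3⌊L/2⌋ : ∀ L → 2 ≤ L → L ≤ 3 * ⌊ L /2⌋
L≤3⌊L/2⌋ L 2≤L = begin
  L                             ≡⟨ ⌊n/2⌋+⌈n/2⌉≡n L ⟨
  -- ⌈ L /2⌉ = ⌊ 1 + L /2⌋ ≤ ⌊ 2 + L /2⌋ = 1 + ⌊ L /2⌋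
  ⌊ L /2⌋ + ⌈ L /2⌉             ≤⟨ +-monoʳ-≤ ⌊ L /2⌋ (⌊n/2⌋-mono (n≤1+n (suc L))) ⟩
  ⌊ L /2⌋ + suc ⌊ L /2⌋         ≤⟨ +-monoʳ-≤ ⌊ L /2⌋ (+-monoˡ-≤ ⌊ L /2⌋ (⌊n/2⌋-mono 2≤L)) ⟩
  ⌊ L /2⌋ + (⌊ L /2⌋ + ⌊ L /2⌋) ≡⟨ triple ⌊ L /2⌋ ⟩
  3 * ⌊ L /2⌋                   ∎
  where
  open ≤-Reasoning
  triple : ∀ j → j + (j + j) ≡ 3 * j
  triple = solve-∀

n≤[1+n/d]*d : ∀ n d .{{_ : NonZero d}} → n ≤ suc (n / d) * d
n≤[1+n/d]*d n d = begin
  n                 ≡⟨ m≡m%n+[m/n]*n n d ⟩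
  n % d + n / d * d ≤⟨ +-monoˡ-≤ (n / d * d) (<⇒≤ (m%n<n n d)) ⟩
  d + n / d * d     ∎
  where open ≤-Reasoning

[1+n/d]*d≤d+n : ∀ n d .{{_ : NonZero d}} → suc (n / d) * d ≤ d + n
[1+n/d]*d≤d+n n d = +-monoʳ-≤ d (m/n*n≤m n d)

-- Lower bound by counting

funToFin-cong : ∀ {m n} {f g : Fin m → Fin n} → f ≗ g → funToFin f ≡ funToFin g
funToFin-cong {zero}  _   = refl
funToFin-cong {suc m} f≗g = cong₂ combine (f≗g zero) (funToFin-cong (f≗g ∘ suc))

funToFin-injective : ∀ {m n} {f g : Fin m → Fin n} → funToFin f ≡ funToFin g → f ≗ g
funToFin-injective {m} {n} {f} {g} eq i =
  trans (sym (finToFun-funToFin f i))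
        (trans (cong (λ x → finToFun {n} {m} x i) eq) (finToFun-funToFin g i))

finToFun-injective : ∀ {m n} {x y : Fin (m ^ n)} → finToFun {m} {n} x ≗ finToFun y → x ≡ y
finToFun-injective {m} {n} {x} {y} x≗y =
  trans (sym (funToFin-finToFin {n} {m} x)) (trans (funToFin-cong x≗y) (funToFin-finToFin {n} {m} y))

subsetOf : ∀ {n} → Fin (2 ^ n) → Subset n
subsetOf {n} x = Vec.tabulate (Inverse.to 2↔Bool ∘ finToFun {2} {n} x)

subsetOf-injective : ∀ {n} → Injective _≡_ _≡_ (subsetOf {n})
subsetOf-injective {n} {x} {y} eq = finToFun-injective λ i → Injection.injective (↔⇒↣ 2↔Bool) (begin
  Inverse.to 2↔Bool (finToFun {2} {n} x i) ≡⟨ lookup∘tabulate _ i ⟨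
  Vec.lookup (subsetOf x) i                ≡⟨ cong (λ a → Vec.lookup a i) eq ⟩
  Vec.lookup (subsetOf y) i                ≡⟨ lookup∘tabulate _ i ⟩
  Inverse.to 2↔Bool (finToFun {2} {n} y i) ∎)
  where open ≡-Reasoning

∣_∣ᶠ : ∀ {n} → Subset n → Fin (suc n)
∣ p ∣ᶠ = fromℕ< (s≤s (∣p∣≤n p))

∣∣ᶠ-≡⇒∣∣-≡ : ∀ {n} (p q : Subset n) → ∣ p ∣ᶠ ≡ ∣ q ∣ᶠ → ∣ p ∣ ≡ ∣ q ∣
∣∣ᶠ-≡⇒∣∣-≡ p q = fromℕ<-injective _ _ (s≤s (∣p∣≤n p)) (s≤s (∣p∣≤n q))

jaccardCode : ∀ {n} → Subset n → Subset n → Fin (suc n * suc n)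
jaccardCode a r = combine ∣ a Δ r ∣ᶠ ∣ a ∪ r ∣ᶠ

jaccardCode-≡⇒Jac-≡ : ∀ {n} (a r b s : Subset n) → jaccardCode a r ≡ jaccardCode b s → Jac a r ≡ Jac b s
jaccardCode-≡⇒Jac-≡ a r b s eq = begin
  Jac a r                       ≡⟨ Jac≡ratio a r ⟩
  ratio (∣ a Δ r ∣) ∣ a ∪ r ∣   ≡⟨ cong₂ ratio
      (∣∣ᶠ-≡⇒∣∣-≡ (a Δ r) (b Δ s) (combine-injectiveˡ ∣ a Δ r ∣ᶠ ∣ a ∪ r ∣ᶠ ∣ b Δ s ∣ᶠ ∣ b ∪ s ∣ᶠ eq))
      (∣∣ᶠ-≡⇒∣∣-≡ (a ∪ r) (b ∪ s) (combine-injectiveʳ ∣ a Δ r ∣ᶠ ∣ a ∪ r ∣ᶠ ∣ b Δ s ∣ᶠ ∣ b ∪ s ∣ᶠ eq)) ⟩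
  ratio (∣ b Δ s ∣) ∣ b ∪ s ∣   ≡⟨ Jac≡ratio b s ⟨
  Jac b s                       ∎
  where open ≡-Reasoning

resolving⇒2^n≤ : ∀ {n} {R : List (Subset n)} → Resolves R → 2 ^ n ≤ (suc n * suc n) ^ length R
resolving⇒2^n≤ {n} {R} (_ , resolves) = injective⇒≤ {f = funToFin ∘ codes ∘ subsetOf}
  λ {x} {y} → subsetOf-injective ∘ resolves ∘ Jac-agree (subsetOf x) (subsetOf y) ∘ funToFin-injective
  where
  codes : Subset n → Fin (length R) → Fin (suc n * suc n)
  codes a i = jaccardCode a (lookup R i)
  Jac-agree : ∀ a b → codes a ≗ codes b → map (Jac a) R ≡ map (Jac b) R
  Jac-agree a b a≗b = map-cong-local (subst (All _) (tabulate-lookup R)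
    (tabulate⁺ λ i → jaccardCode-≡⇒Jac-≡ a (lookup R i) b (lookup R i) (a≗b i)))

metricDim-lower : ∀ {n k} → IsMetricDim n k → n ≤ 2 * suc ⌊log₂ n ⌋ * k
metricDim-lower {n} ((R , _ , resolves , refl) , _) = 2^-cancel-≤ (begin
  2 ^ n                        ≤⟨ resolving⇒2^n≤ resolves ⟩
  (suc n * suc n) ^ k          ≤⟨ ^-monoˡ-≤ k (*-mono-≤ (n<2^[1+⌊log₂n⌋] n) (n<2^[1+⌊log₂n⌋] n)) ⟩
  (2 ^ suc L * 2 ^ suc L) ^ k  ≡⟨ cong (_^ k) (^-distribˡ-+-* 2 (suc L) (suc L)) ⟨
  (2 ^ (suc L + suc L)) ^ k    ≡⟨ ^-*-assoc 2 (suc L + suc L) k ⟩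
  2 ^ ((suc L + suc L) * k)    ≡⟨ cong (λ e → 2 ^ (e * k)) (l+l≡2*l (suc L)) ⟩
  2 ^ (2 * suc L * k)          ∎)
  where
  open ≤-Reasoning
  L = ⌊log₂ n ⌋
  k = length R
  l+l≡2*l : ∀ l → l + l ≡ 2 * l
  l+l≡2*l = solve-∀

-- Detecting families

Detecting : ∀ {I : Set} {n} → (I → Subset n) → Set
Detecting D = ∀ {a b} → (∀ i → ∣ a ∩ D i ∣ ≡ ∣ b ∩ D i ∣) → a ≡ b

DetectingFamily : ℕ → ℕ → Set
DetectingFamily m n = Σ (Fin m → Subset n) Detecting

reindex : ∀ {I : Set} {m n} {D : I → Subset n} (e : Fin m ↔ I) → Detecting D → DetectingFamily m n
reindex {D = D} e det = D ∘ to , λ {a} {b} h → det λ i →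
  subst (λ j → ∣ a ∩ D j ∣ ≡ ∣ b ∩ D j ∣) (strictlyInverseˡ i) (h (from i))
  where open Inverse e

⁅⁆-detecting : ∀ {n} → Detecting (⁅_⁆ {n})
⁅⁆-detecting {a = []}          {[]}          h = refl
⁅⁆-detecting {a = inside ∷ a}  {inside ∷ b}  h = cong (inside ∷_) (⁅⁆-detecting (h ∘ suc))
⁅⁆-detecting {a = outside ∷ a} {outside ∷ b} h = cong (outside ∷_) (⁅⁆-detecting (h ∘ suc))
⁅⁆-detecting {a = inside ∷ a}  {outside ∷ b} h = ⊥-elim (1+n≢0 (trans (h zero) (∣p∩⊥∣≡0 b)))
⁅⁆-detecting {a = outside ∷ a} {inside ∷ b}  h = ⊥-elim (1+n≢0 (trans (sym (h zero)) (∣p∩⊥∣≡0 a)))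

_⊕_ : ∀ {m₁ n₁ m₂ n₂} → DetectingFamily m₁ n₁ → DetectingFamily m₂ n₂ →
      DetectingFamily (m₁ + m₂) (n₁ + n₂)
_⊕_ {n₁ = n₁} {n₂ = n₂} (D₁ , det₁) (D₂ , det₂) = reindex +↔⊎ det
  where
  det : Detecting [ (_++ ⊥) ∘ D₁ , (⊥ ++_) ∘ D₂ ]′
  det {a} {b} h with Vec.splitAt n₁ a | Vec.splitAt n₁ b
  ... | x , y , refl | x′ , y′ , refl = cong₂ _++_
    (det₁ {x} {x′} λ i →
      subst₂ _≡_ (∣p++q∩r++⊥∣≡∣p∩r∣ x (D₁ i) y) (∣p++q∩r++⊥∣≡∣p∩r∣ x′ (D₁ i) y′) (h (inj₁ i)))
    (det₂ {y} {y′} λ j →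
      subst₂ _≡_ (∣p++q∩⊥++s∣≡∣q∩s∣ x y (D₂ j)) (∣p++q∩⊥++s∣≡∣q∩s∣ x′ y′ (D₂ j)) (h (inj₂ j)))

⊕-replicate : ∀ {m n} B → DetectingFamily m n → DetectingFamily (B * m) (B * n)
⊕-replicate zero    _ = (λ ()) , λ { {[]} {[]} _ → refl }
⊕-replicate (suc B) F = F ⊕ ⊕-replicate B F

restrict : ∀ {m n k} → DetectingFamily m (n + k) → DetectingFamily m n
restrict {n = n} (D , det) = take n ∘ D , λ {a} {b} h → ++-injectiveˡ a b (det λ i →
  subst₂ _≡_ (sym (∣p++⊥∩q∣≡∣p∩take∣ a (D i))) (sym (∣p++⊥∩q∣≡∣p∩take∣ b (D i))) (h i))

cover : ∀ {m d} .{{_ : NonZero d}} → DetectingFamily m d → ∀ n → DetectingFamily (suc (n / d) * m) n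
cover {d = d} F n = restrict (subst (DetectingFamily _) (sym (m+[n∸m]≡n (n≤[1+n/d]*d n d)))
                                    (⊕-replicate (suc (n / d)) F))

-- The doubling construction

bit+double-injective : ∀ {b x b′ x′} → b < 2 → b′ < 2 → b + x * 2 ≡ b′ + x′ * 2 → b ≡ b′ × x ≡ x′
bit+double-injective {b} {x} {b′} {x′} b<2 b′<2 eq = b≡b′ , x≡x′
  where
  open ≡-Reasoning
  b≡b′ : b ≡ b′
  b≡b′ = begin
    b                ≡⟨ m<n⇒m%n≡m b<2 ⟨
    b % 2            ≡⟨ [m+kn]%n≡m%n b x 2 ⟨
    (b + x * 2) % 2   ≡⟨ cong (_% 2) eq ⟩
    (b′ + x′ * 2) % 2 ≡⟨ [m+kn]%n≡m%n b′ x′ 2 ⟩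
    b′ % 2           ≡⟨ m<n⇒m%n≡m b′<2 ⟩
    b′               ∎
  x≡x′ : x ≡ x′
  x≡x′ = *-cancelʳ-≡ x x′ 2 (+-cancelˡ-≡ b′ _ _ (subst (λ c → c + x * 2 ≡ b′ + x′ * 2) b≡b′ eq))

-- X, Y, Z are the weights of x, y, z on D i, D i, ⁅ i ⁆, and Y̅ that of y on ∁ (D i).
doubling-decode : ∀ {X Y Y̅ Z X′ Y′ Y̅′ Z′} → Z < 2 → Z′ < 2 → Y̅ + Y ≡ Y̅′ + Y′ →
                  X + (Y + Z) ≡ X′ + (Y′ + Z′) → X + Y̅ ≡ X′ + Y̅′ →
                  X ≡ X′ × Y ≡ Y′ × Z ≡ Z′
doubling-decode {X} {Y} {Y̅} {Z} {X′} {Y′} {Y̅′} {Z′} Z<2 Z′<2 ∣y∣≡ rowA rowB = X≡X′ , Y≡Y′ , Z≡Z′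
  where
  open ≡-Reasoning
  rows-sum : ∀ X Y Y̅ Z → X + (Y + Z) + (X + Y̅) ≡ Z + X * 2 + (Y̅ + Y)
  rows-sum = solve-∀
  parity : Z + X * 2 ≡ Z′ + X′ * 2
  parity = +-cancelʳ-≡ (Y̅′ + Y′) _ _ (begin
    Z + X * 2 + (Y̅′ + Y′)        ≡⟨ cong (Z + X * 2 +_) ∣y∣≡ ⟨
    Z + X * 2 + (Y̅ + Y)          ≡⟨ rows-sum X Y Y̅ Z ⟨
    X + (Y + Z) + (X + Y̅)        ≡⟨ cong₂ _+_ rowA rowB ⟩
    X′ + (Y′ + Z′) + (X′ + Y̅′)    ≡⟨ rows-sum X′ Y′ Y̅′ Z′ ⟩
    Z′ + X′ * 2 + (Y̅′ + Y′)      ∎)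
  Z≡Z′ : Z ≡ Z′
  Z≡Z′ = proj₁ (bit+double-injective {Z} {X} {Z′} {X′} Z<2 Z′<2 parity)
  X≡X′ : X ≡ X′
  X≡X′ = proj₂ (bit+double-injective {Z} {X} {Z′} {X′} Z<2 Z′<2 parity)
  Y≡Y′ : Y ≡ Y′
  Y≡Y′ = +-cancelʳ-≡ Z′ Y Y′ (+-cancelˡ-≡ X′ _ _
    (subst₂ (λ u v → u + (Y + v) ≡ X′ + (Y′ + Z′)) X≡X′ Z≡Z′ rowA))

doubledRow : ∀ {m n} → (Fin m → Subset n) → Fin 1 ⊎ (Fin m ⊎ Fin m) → Subset (n + (n + m))
doubledRow {m} {n} D (inj₁ _)        = ⊥ {n} ++ ⊤ {n} ++ ⊥ {m}
doubledRow {m} {n} D (inj₂ (inj₁ i)) = D i ++ D i ++ ⁅ i ⁆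
doubledRow {m} {n} D (inj₂ (inj₂ i)) = D i ++ ∁ (D i) ++ ⊥ {m}

module _ {m n} (D : Fin m → Subset n) (x y : Subset n) (z : Subset m) where

  doubledRow-⋆ : ∣ (x ++ y ++ z) ∩ doubledRow D (inj₁ zero) ∣ ≡ ∣ y ∣
  doubledRow-⋆ = trans (∣p++q∩⊥++s∣≡∣q∩s∣ x (y ++ z) (⊤ {n} ++ ⊥ {m}))
                       (trans (∣p++q∩r++⊥∣≡∣p∩r∣ y ⊤ z) (∣p∩⊤∣≡∣p∣ y))

  doubledRow-D : ∀ i → ∣ (x ++ y ++ z) ∩ doubledRow D (inj₂ (inj₁ i)) ∣ ≡
                       ∣ x ∩ D i ∣ + (∣ y ∩ D i ∣ + ∣ z ∩ ⁅ i ⁆ ∣)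
  doubledRow-D i = trans (∣p++q∩r++s∣ x (D i) (y ++ z) (D i ++ ⁅ i ⁆))
                         (cong (∣ x ∩ D i ∣ +_) (∣p++q∩r++s∣ y (D i) z ⁅ i ⁆))

  doubledRow-∁ : ∀ i → ∣ (x ++ y ++ z) ∩ doubledRow D (inj₂ (inj₂ i)) ∣ ≡ ∣ x ∩ D i ∣ + ∣ y ∩ ∁ (D i) ∣
  doubledRow-∁ i = trans (∣p++q∩r++s∣ x (D i) (y ++ z) (∁ (D i) ++ ⊥))
                         (cong (∣ x ∩ D i ∣ +_) (∣p++q∩r++⊥∣≡∣p∩r∣ y (∁ (D i)) z))

doubledRow-detecting : ∀ {m n} {D : Fin m → Subset n} → Detecting D → Detecting (doubledRow D)
doubledRow-detecting {m} {n} {D} det {a} {b} h with Vec.splitAt n a | Vec.splitAt n b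
... | x , w , refl | x′ , w′ , refl with Vec.splitAt n w | Vec.splitAt n w′
... | y , z , refl | y′ , z′ , refl =
  cong₂ _++_ (det {x} {x′} (proj₁ ∘ decode))
    (cong₂ _++_ (det {y} {y′} (proj₁ ∘ proj₂ ∘ decode))
                (⁅⁆-detecting {a = z} {z′} (proj₂ ∘ proj₂ ∘ decode)))
  where
  ∣y∣≡∣y′∣ : ∣ y ∣ ≡ ∣ y′ ∣
  ∣y∣≡∣y′∣ = subst₂ _≡_ (doubledRow-⋆ D x y z) (doubledRow-⋆ D x′ y′ z′) (h (inj₁ zero))
  bit : ∀ (p : Subset m) i → ∣ p ∩ ⁅ i ⁆ ∣ < 2
  bit p i = s≤s (≤-trans (∣p∩q∣≤∣q∣ p ⁅ i ⁆) (≤-reflexive (∣⁅x⁆∣≡1 i)))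
  decode : ∀ i → ∣ x ∩ D i ∣ ≡ ∣ x′ ∩ D i ∣ × ∣ y ∩ D i ∣ ≡ ∣ y′ ∩ D i ∣ × ∣ z ∩ ⁅ i ⁆ ∣ ≡ ∣ z′ ∩ ⁅ i ⁆ ∣
  decode i = doubling-decode (bit z i) (bit z′ i)
    (trans (∣p∩∁q∣+∣p∩q∣≡∣p∣ y (D i)) (trans ∣y∣≡∣y′∣ (sym (∣p∩∁q∣+∣p∩q∣≡∣p∣ y′ (D i)))))
    (subst₂ _≡_ (doubledRow-D D x y z i) (doubledRow-D D x′ y′ z′ i) (h (inj₂ (inj₁ i))))
    (subst₂ _≡_ (doubledRow-∁ D x y z i) (doubledRow-∁ D x′ y′ z′ i) (h (inj₂ (inj₂ i))))

double : ∀ {m n} → DetectingFamily m n → DetectingFamily (suc (m + m)) (n + (n + m))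
double (_ , det) = reindex (↔-trans +↔⊎ (↔-refl ⊎-↔ +↔⊎)) (doubledRow-detecting det)

doubledRows : ℕ → ℕ
doubledRows zero    = 1
doubledRows (suc j) = suc (doubledRows j + doubledRows j)

doubledCols : ℕ → ℕ
doubledCols zero    = 1
doubledCols (suc j) = doubledCols j + (doubledCols j + doubledRows j)

doubledFamily : ∀ j → DetectingFamily (doubledRows j) (doubledCols j)
doubledFamily zero    = ⁅_⁆ , ⁅⁆-detecting
doubledFamily (suc j) = double (doubledFamily j)

1+doubledRows≡2^[1+j] : ∀ j → suc (doubledRows j) ≡ 2 ^ suc j
1+doubledRows≡2^[1+j] zero    = refl
1+doubledRows≡2^[1+j] (suc j) =
  trans (double-suc (doubledRows j)) (cong (2 *_) (1+doubledRows≡2^[1+j] j))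
  where
  double-suc : ∀ r → suc (suc (r + r)) ≡ 2 * suc r
  double-suc = solve-∀

doubledCols≡j*2^j+1 : ∀ j → doubledCols j ≡ j * 2 ^ j + 1
doubledCols≡j*2^j+1 zero    = refl
doubledCols≡j*2^j+1 (suc j) = begin
  doubledCols j + (doubledCols j + doubledRows j)
    ≡⟨ cong (λ c → c + (c + doubledRows j)) (doubledCols≡j*2^j+1 j) ⟩
  (j * 2 ^ j + 1) + ((j * 2 ^ j + 1) + doubledRows j)
    ≡⟨ regroup (j * 2 ^ j) (doubledRows j) ⟩
  j * 2 ^ j + j * 2 ^ j + 1 + suc (doubledRows j)
    ≡⟨ cong (j * 2 ^ j + j * 2 ^ j + 1 +_) (1+doubledRows≡2^[1+j] j) ⟩
  j * 2 ^ j + j * 2 ^ j + 1 + 2 * 2 ^ j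
    ≡⟨ collect j (2 ^ j) ⟩
  suc j * (2 * 2 ^ j) + 1 ∎
  where
  open ≡-Reasoning
  regroup : ∀ c r → (c + 1) + ((c + 1) + r) ≡ c + c + 1 + suc r
  regroup = solve-∀
  collect : ∀ j p → j * p + j * p + 1 + 2 * p ≡ (1 + j) * (2 * p) + 1
  collect = solve-∀

doubledCols-nonZero : ∀ j → NonZero (doubledCols j)
doubledCols-nonZero j = subst NonZero (trans (+-comm 1 (j * 2 ^ j)) (sym (doubledCols≡j*2^j+1 j))) _

doubledCols≤2^[j+j] : ∀ j → doubledCols j ≤ 2 ^ (j + j)
doubledCols≤2^[j+j] j = begin
  doubledCols j        ≡⟨ doubledCols≡j*2^j+1 j ⟩
  j * 2 ^ j + 1        ≤⟨ +-monoʳ-≤ (j * 2 ^ j) (m^n>0 2 j) ⟩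
  j * 2 ^ j + 2 ^ j    ≡⟨ +-comm (j * 2 ^ j) (2 ^ j) ⟩
  suc j * 2 ^ j        ≤⟨ *-monoˡ-≤ (2 ^ j) (n<2^n j) ⟩
  2 ^ j * 2 ^ j        ≡⟨ ^-distribˡ-+-* 2 j j ⟨
  2 ^ (j + j)          ∎
  where open ≤-Reasoning

cover-size : ∀ j n → doubledCols j ≤ n →
             suc ((n / doubledCols j) {{doubledCols-nonZero j}}) * doubledRows j * (3 * j) ≤ 12 * n
cover-size j n d≤n = begin
  B * doubledRows j * (3 * j) ≤⟨ *-monoˡ-≤ (3 * j) (*-monoʳ-≤ B rows≤2*2^j) ⟩
  B * (2 * 2 ^ j) * (3 * j)   ≡⟨ regroup B (2 ^ j) j ⟩
  6 * (B * (j * 2 ^ j))       ≤⟨ *-monoʳ-≤ 6 (*-monoʳ-≤ B j*2^j≤d) ⟩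
  6 * (B * d)                 ≤⟨ *-monoʳ-≤ 6 (≤-trans ([1+n/d]*d≤d+n n d) (+-monoˡ-≤ n d≤n)) ⟩
  6 * (n + n)                 ≡⟨ twelve n ⟩
  12 * n                      ∎
  where
  open ≤-Reasoning
  instance
    d≢0 : NonZero (doubledCols j)
    d≢0 = doubledCols-nonZero j
  d = doubledCols j
  B = suc (n / d)
  rows≤2*2^j : doubledRows j ≤ 2 * 2 ^ j
  rows≤2*2^j = ≤-trans (n≤1+n _) (≤-reflexive (1+doubledRows≡2^[1+j] j))
  j*2^j≤d : j * 2 ^ j ≤ d
  j*2^j≤d = ≤-trans (m≤m+n _ 1) (≤-reflexive (sym (doubledCols≡j*2^j+1 j)))
  regroup : ∀ b p j → b * (2 * p) * (3 * j) ≡ 6 * (b * (j * p))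
  regroup = solve-∀
  twelve : ∀ n → 6 * (n + n) ≡ 12 * n
  twelve = solve-∀

-- Upper bound

map-≡⁻ : ∀ {A B : Set} {f g : A → B} (xs : List A) → map f xs ≡ map g xs → ∀ {x} → x ∈ xs → f x ≡ g x
map-≡⁻ (x ∷ xs) eq (here refl) = ∷-injectiveˡ eq
map-≡⁻ (x ∷ xs) eq (there x∈xs) = map-≡⁻ xs (∷-injectiveʳ eq) x∈xs

detecting⇒resolving : ∀ {m n} → DetectingFamily m n →
                      Σ (List (Subset n)) λ R → Unique R × Resolves R × length R ≤ suc m
detecting⇒resolving {m} {n} (D , det) =
  R′ , deduplicate-! _≟ˢ_ R , (R′-nonEmpty , resolves) , R′≤1+m
  where
  R R′ : List (Subset n)
  R  = ⊤ ∷ tabulate D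
  R′ = deduplicate _≟ˢ_ R
  R′-nonEmpty : Any.Any (λ _ → Unit.⊤) R′
  R′-nonEmpty = Any.map (λ _ → Unit.tt) (∈-deduplicate⁺ _≟ˢ_ {xs = R} (here refl))
  R′≤1+m : length R′ ≤ suc m
  R′≤1+m = ≤-trans (length-deduplicate _≟ˢ_ R) (≤-reflexive (cong suc (length-tabulate D)))
  resolves : Injective _≡_ _≡_ (λ a → map (Jac a) R′)
  resolves {a} {b} eq = det {a} {b} λ i → Jac⇒∣∩∣≡ a b (D i) ∣a∣≡∣b∣ (Jac-agree (there (∈-tabulate⁺ i)))
    where
    Jac-agree : ∀ {r} → r ∈ R → Jac a r ≡ Jac b r
    Jac-agree r∈R = map-≡⁻ R′ eq (∈-deduplicate⁺ _≟ˢ_ r∈R)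
    ∣a∣≡∣b∣ : ∣ a ∣ ≡ ∣ b ∣
    ∣a∣≡∣b∣ = Jac-⊤⇒∣∣≡ a b (Jac-agree (here refl))

detecting⇒metricDim≤1+m : ∀ {m n k} → DetectingFamily m n → IsMetricDim n k → k ≤ suc m
detecting⇒metricDim≤1+m F (_ , minimal) with detecting⇒resolving F
... | R , unique , resolves , R≤1+m = ≤-trans (minimal R unique resolves) R≤1+m

metricDim-upper : ∀ {n k} → 4 ≤ n → IsMetricDim n k → k * ⌊log₂ n ⌋ ≤ 13 * n
metricDim-upper {n} {k} 4≤n dim = begin
  k * L                           ≤⟨ *-monoˡ-≤ L (detecting⇒metricDim≤1+m (cover (doubledFamily j) n) dim) ⟩
  L + B * doubledRows j * L       ≤⟨ +-monoʳ-≤ L (*-monoʳ-≤ (B * doubledRows j) (L≤3⌊L/2⌋ L 2≤L)) ⟩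
  L + B * doubledRows j * (3 * j) ≤⟨ +-mono-≤ L≤n (cover-size j n d≤n) ⟩
  n + 12 * n                      ≡⟨ thirteen n ⟩
  13 * n                          ∎
  where
  open ≤-Reasoning
  L = ⌊log₂ n ⌋
  j = ⌊ L /2⌋
  instance
    n≢0 : NonZero n
    n≢0 = >-nonZero (≤-trans (s≤s z≤n) 4≤n)
    d≢0 : NonZero (doubledCols j)
    d≢0 = doubledCols-nonZero j
  B = suc (n / doubledCols j)
  2≤L : 2 ≤ L
  2≤L = ⌊log₂⌋-mono-≤ 4≤n
  L≤n : L ≤ n
  L≤n = ≤-trans (<⇒≤ (n<2^n L)) (2^⌊log₂n⌋≤n n)
  d≤n : doubledCols j ≤ n
  d≤n = ≤-trans (doubledCols≤2^[j+j] j) (≤-trans (^-monoʳ-≤ 2 (⌊n/2⌋+⌊n/2⌋≤n L)) (2^⌊log₂n⌋≤n n))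
  thirteen : ∀ n → n + 12 * n ≡ 13 * n
  thirteen = solve-∀

corollary1 : ∃ λ (C : ℕ) → ∃ λ (N : ℕ) → 1 ≤ N ×
    (∀ (n k : ℕ) → N ≤ n → IsMetricDim n k →
    (n ≤ C * k * ⌊log₂ n ⌋) × (k * ⌊log₂ n ⌋ ≤ C * n))
corollary1 = 13 , 4 , s≤s z≤n , λ n k 4≤n dim →
  ≤-trans (metricDim-lower dim) (2[1+L]k≤13kL (⌊log₂⌋-mono-≤ {2} (≤-trans (s≤s (s≤s z≤n)) 4≤n))) ,
  metricDim-upper 4≤n dim
  where
  2[1+L]k≤13kL : ∀ {L k} → 1 ≤ L → 2 * suc L * k ≤ 13 * k * L
  2[1+L]k≤13kL {L} {k} 1≤L = begin
    2 * suc L * k               ≤⟨ *-monoˡ-≤ k (*-monoʳ-≤ 2 (+-monoˡ-≤ L 1≤L)) ⟩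
    2 * (L + L) * k             ≤⟨ m≤m+n (2 * (L + L) * k) (9 * k * L) ⟩
    2 * (L + L) * k + 9 * k * L ≡⟨ collect L k ⟩
    13 * k * L                  ∎
    where
    open ≤-Reasoning
    collect : ∀ L k → 2 * (L + L) * k + 9 * k * L ≡ 13 * k * L
    collect = solve-∀
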